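{- Let $q\ge 3$ be a prime power and write $\mathbb{F}_q=\{a_0,a_1,\dots,a_{q-1}\}$ with $a_0=0$, $a_1=1$ (the $a_i$ distinct). The map $x\mapsto 1-x$ permutes the set $\{a_2,\dots,a_{q-1}\}$; let $\pi_q$ denote the induced permutation of the indices $\{2,\dots,q-1\}$ (i.e. $a_{\pi_q(i)}=1-a_i$). Then $${\rm sign}(\pi_q)=(-1)^{\frac{(q-2)(q-3)}{2}}.$$ -}

module Defs where

open import Level using (Level; _⊔_) renaming (suc to lsuc)
open import Data.Nat using (ℕ; _^_; _≤_)
open import Data.Nat.Primality using (Prime)
open import Data.Product using (∃; ∃-syntax; _×_)
open import Data.Fin using (Fin; toℕ; _<_)
open import Data.Fin.Properties using (_<?_)
open import Data.List using (List; length; filter; cartesianProduct)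
open import Data.List using () renaming (allFin to allFinL)
open import Data.Product using (_,_; proj₁; proj₂)
open import Data.Integer using (ℤ; -1ℤ) renaming (_^_ to _^ℤ_)
open import Relation.Nullary using (¬_)
open import Relation.Nullary.Decidable using (_×-dec_)
open import Relation.Binary.PropositionalEquality using (_≡_)
open import Algebra.Bundles using (CommutativeRing)

record Field (c ℓ : Level) : Set (lsuc (c ⊔ ℓ)) where
  field
    commutativeRing : CommutativeRing c ℓ
  open CommutativeRing commutativeRing public
  field
    0≉1     : ¬ (0# ≈ 1#)
    inverse : ∀ x → ¬ (x ≈ 0#) → ∃[ y ] (x * y ≈ 1#)

IsPrimePower : ℕ → Set
IsPrimePower q = ∃[ p ] ∃[ k ] (Prime p × 1 ≤ k × q ≡ p ^ k)

inversions : ∀ {n} → (Fin n → Fin n) → ℕ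
inversions {n} f =
  length (filter (λ ij → (proj₁ ij <? proj₂ ij) ×-dec (f (proj₂ ij) <? f (proj₁ ij)))
                 (cartesianProduct (allFinL n) (allFinL n)))

sign : ∀ {n} → (Fin n → Fin n) → ℤ
sign f = -1ℤ ^ℤ inversions f

{-# OPTIONS --safe #-}
module Submission where

-- Since 1 - (1 - x) = x, π is an involution; a fixed point of x ↦ 1 - x satisfies
-- x + x = 1, which has at most one solution (x = x (y + y) = (x + x) y = y), so π fixes
-- at most one index. Comparing i with π j splits the inversions (i, j) of an involution:
-- those with i = π j are the pairs (i, π i) with i < π i, one per 2-cycle, while
-- (i, j) ↦ (π j, π i) matches those with π j < i against those with i < π j. Hence
-- sign π = (-1)^c for c the number of 2-cycles, and n = f + 2c with f ≤ 1 fixed points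
-- gives n (n - 1) / 2 ≡ c (mod 2).

open import Defs
open import Level using (Level)
open import Algebra.Bundles using (Semiring; Ring)
import Algebra.Properties.AbelianGroup as AbelianGroupProperties
import Data.Nat.Properties as ℕ
open import Data.Nat.DivMod using (m*n/n≡m)
open import Data.Nat.Tactic.RingSolver using (solve-∀)
open import Data.Fin using (Fin; zero; suc; _↑ʳ_; punchIn)
open import Data.Fin.Properties using (_<?_; _≟_; <-cmp; suc-injective; ↑ʳ-injective; punchInᵢ≢i)
open import Data.Fin.Permutation using (permutation)
open import Data.List using (_∷_; length; filter; map; _++_; tabulate; cartesianProduct)
open import Data.List.Properties using (length-++; filter-++; map-tabulate)
open import Data.Product using (∃-syntax; _×_; _,_; proj₁; proj₂)
open import Data.Integer using (1ℤ; -1ℤ) renaming (_^_ to _^ℤ_; _*_ to _*ℤ_)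
import Data.Integer.Properties as ℤ
open import Function using (_∘_; id)
open import Relation.Binary.Definitions using (tri<; tri≈; tri>)
open import Relation.Binary.PropositionalEquality
  using (_≡_; refl; sym; trans; cong; cong₂; subst; module ≡-Reasoning)
open import Relation.Nullary using (¬_; Dec; yes; no; contradiction)
open import Relation.Nullary.Decidable using (_×-dec_)
open import Relation.Unary using (Decidable)
open import Algebra.Properties.CommutativeMonoid.Sum ℕ.+-0-commutativeMonoid
  using (sum; sum-cong-≗; sum-permute; sum-remove; sum-replicate-zero; ∑-distrib-+; ∑-comm)

module _ {c ℓ} (R : Semiring c ℓ) where
  open Semiring R
  open import Relation.Binary.Reasoning.Setoid setoid

  halves-unique : ∀ {x y} → x + x ≈ 1# → y + y ≈ 1# → x ≈ y
  halves-unique {x} {y} x+x≈1 y+y≈1 = begin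
    x             ≈⟨ *-identityʳ x ⟨
    x * 1#        ≈⟨ *-congˡ y+y≈1 ⟨
    x * (y + y)   ≈⟨ distribˡ x y y ⟩
    x * y + x * y ≈⟨ distribʳ y x x ⟨
    (x + x) * y   ≈⟨ *-congʳ x+x≈1 ⟩
    1# * y        ≈⟨ *-identityˡ y ⟩
    y             ∎

module _ {c ℓ} (R : Ring c ℓ) where
  open Ring R
  open AbelianGroupProperties +-abelianGroup using (⁻¹-anti-homo‿-)
  open import Relation.Binary.Reasoning.Setoid setoid

  1-[1-x]≈x : ∀ x → 1# - (1# - x) ≈ x
  1-[1-x]≈x x = begin
    1# - (1# - x)    ≈⟨ +-congˡ (⁻¹-anti-homo‿- 1# x) ⟩
    1# + (x - 1#)    ≈⟨ +-comm 1# (x - 1#) ⟩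
    (x - 1#) + 1#    ≈⟨ +-assoc x (- 1#) 1# ⟩
    x + (- 1# + 1#)  ≈⟨ +-congˡ (-‿inverseˡ 1#) ⟩
    x + 0#           ≈⟨ +-identityʳ x ⟩
    x                ∎

  x≈1-x⇒x+x≈1 : ∀ {x} → x ≈ 1# - x → x + x ≈ 1#
  x≈1-x⇒x+x≈1 {x} x≈1-x = begin
    x + x          ≈⟨ +-congʳ x≈1-x ⟩
    (1# - x) + x   ≈⟨ +-assoc 1# (- x) x ⟩
    1# + (- x + x) ≈⟨ +-congˡ (-‿inverseˡ x) ⟩
    1# + 0#        ≈⟨ +-identityʳ 1# ⟩
    1#             ∎

open import Data.Nat using (ℕ; zero; suc; _≤_; _+_; _∸_; _*_; _/_; z≤n; s≤s)

private variable
  p q : Level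
  P : Set p
  Q : Set q

𝟙 : Dec P → ℕ
𝟙 (yes _) = 1
𝟙 (no _)  = 0

𝟙-yes : P → (d : Dec P) → 𝟙 d ≡ 1
𝟙-yes _ (yes _) = refl
𝟙-yes p (no ¬p) = contradiction p ¬p

𝟙-no : ¬ P → (d : Dec P) → 𝟙 d ≡ 0
𝟙-no ¬p (yes p) = contradiction p ¬p
𝟙-no _  (no _)  = refl

𝟙-cong : (P → Q) → (Q → P) → (d : Dec P) (e : Dec Q) → 𝟙 d ≡ 𝟙 e
𝟙-cong P⇒Q _   (yes p) e = sym (𝟙-yes (P⇒Q p) e)
𝟙-cong _   Q⇒P (no ¬p) e = sym (𝟙-no (¬p ∘ Q⇒P) e)

𝟙-×-dec : (d : Dec P) (e : Dec Q) → 𝟙 (d ×-dec e) ≡ 𝟙 d * 𝟙 e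
𝟙-×-dec (yes _) (yes _) = refl
𝟙-×-dec (yes _) (no _)  = refl
𝟙-×-dec (no _)  _       = refl

𝟙-idem : (d : Dec P) → 𝟙 d * 𝟙 d ≡ 𝟙 d
𝟙-idem (yes _) = refl
𝟙-idem (no _)  = refl

𝟙-trichotomy : ∀ {n} (i j : Fin n) → 𝟙 (i ≟ j) + (𝟙 (i <? j) + 𝟙 (j <? i)) ≡ 1
𝟙-trichotomy i j with <-cmp i j
... | tri< i<j i≢j j≮i =
  cong₂ _+_ (𝟙-no i≢j (i ≟ j)) (cong₂ _+_ (𝟙-yes i<j (i <? j)) (𝟙-no j≮i (j <? i)))
... | tri≈ i≮j i≡j j≮i =
  cong₂ _+_ (𝟙-yes i≡j (i ≟ j)) (cong₂ _+_ (𝟙-no i≮j (i <? j)) (𝟙-no j≮i (j <? i)))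
... | tri> i≮j i≢j j<i =
  cong₂ _+_ (𝟙-no i≢j (i ≟ j)) (cong₂ _+_ (𝟙-no i≮j (i <? j)) (𝟙-yes j<i (j <? i)))

module _ {a p} {A : Set a} {P : A → Set p} (P? : Decidable P) where

  length-filter-∷ : ∀ x xs → length (filter P? (x ∷ xs)) ≡ 𝟙 (P? x) + length (filter P? xs)
  length-filter-∷ x xs with P? x
  ... | yes _ = refl
  ... | no _  = refl

  length-filter-++ : ∀ xs ys →
    length (filter P? (xs ++ ys)) ≡ length (filter P? xs) + length (filter P? ys)
  length-filter-++ xs ys = trans (cong length (filter-++ P? xs ys)) (length-++ (filter P? xs))

  length-filter-tabulate : ∀ {n} (f : Fin n → A) →
    length (filter P? (tabulate f)) ≡ sum (λ i → 𝟙 (P? (f i)))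
  length-filter-tabulate {zero}  f = refl
  length-filter-tabulate {suc n} f =
    trans (length-filter-∷ (f zero) _) (cong (𝟙 (P? (f zero)) +_) (length-filter-tabulate (f ∘ suc)))

module _ {a b p} {A : Set a} {B : Set b} {P : A × B → Set p} (P? : Decidable P) where

  length-filter-cartesianProduct : ∀ {m n} (f : Fin m → A) (g : Fin n → B) →
    length (filter P? (cartesianProduct (tabulate f) (tabulate g)))
      ≡ sum (λ i → sum (λ j → 𝟙 (P? (f i , g j))))
  length-filter-cartesianProduct {zero}  f g = refl
  length-filter-cartesianProduct {suc m} f g =
    trans (length-filter-++ P? (map (f zero ,_) (tabulate g)) _)
          (cong₂ _+_ (trans (cong (length ∘ filter P?) (map-tabulate g (f zero ,_)))
                            (length-filter-tabulate P? ((f zero ,_) ∘ g)))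
                     (length-filter-cartesianProduct (f ∘ suc) g))

inversions≡∑∑ : ∀ {n} (π : Fin n → Fin n) →
  inversions π ≡ sum (λ i → sum (λ j → 𝟙 (i <? j) * 𝟙 (π j <? π i)))
inversions≡∑∑ π = trans
  (length-filter-cartesianProduct (λ ij → (proj₁ ij <? proj₂ ij) ×-dec (π (proj₂ ij) <? π (proj₁ ij))) id id)
  (sum-cong-≗ λ i → sum-cong-≗ λ j → 𝟙-×-dec (i <? j) (π j <? π i))

sum-zero : ∀ {n} {f : Fin n → ℕ} → (∀ i → f i ≡ 0) → sum f ≡ 0
sum-zero {n} f≗0 = trans (sum-cong-≗ f≗0) (sum-replicate-zero n)

sum-ones : ∀ n → sum {n} (λ _ → 1) ≡ n
sum-ones zero    = refl
sum-ones (suc n) = cong suc (sum-ones n)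

sum-δ : ∀ {n} (f : Fin n → ℕ) k → sum (λ j → f j * 𝟙 (j ≟ k)) ≡ f k
sum-δ {suc n} f k = begin
  sum (λ j → f j * 𝟙 (j ≟ k))
    ≡⟨ sum-remove {i = k} (λ j → f j * 𝟙 (j ≟ k)) ⟩
  f k * 𝟙 (k ≟ k) + sum (λ j → f (punchIn k j) * 𝟙 (punchIn k j ≟ k))
    ≡⟨ cong₂ _+_ (cong (f k *_) (𝟙-yes refl (k ≟ k)))
                 (sum-zero λ j → trans (cong (f (punchIn k j) *_) (𝟙-no (punchInᵢ≢i k j) _))
                                       (ℕ.*-zeroʳ (f (punchIn k j)))) ⟩
  f k * 1 + 0
    ≡⟨ trans (ℕ.+-identityʳ (f k * 1)) (ℕ.*-identityʳ (f k)) ⟩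
  f k ∎
  where open ≡-Reasoning

sum-𝟙≤1 : ∀ {n} {P : Fin n → Set p} (P? : Decidable P) →
  (∀ {i j} → P i → P j → i ≡ j) → sum (λ i → 𝟙 (P? i)) ≤ 1
sum-𝟙≤1 {n = zero}  _  _      = z≤n
sum-𝟙≤1 {n = suc n} P? unique with P? zero
... | yes P0 = ℕ.≤-reflexive (cong suc (sum-zero λ i → 𝟙-no (λ Pi → 0≢suc (unique P0 Pi)) (P? (suc i))))
  where 0≢suc : ∀ {i : Fin n} → ¬ zero ≡ suc i
        0≢suc ()
... | no _   = sum-𝟙≤1 (P? ∘ suc) (λ Pi Pj → suc-injective (unique Pi Pj))

∑∑ : ∀ {n} → (Fin n → Fin n → ℕ) → ℕ
∑∑ g = sum (λ i → sum (g i))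

∑∑-distrib-+ : ∀ {n} (g h : Fin n → Fin n → ℕ) → ∑∑ (λ i j → g i j + h i j) ≡ ∑∑ g + ∑∑ h
∑∑-distrib-+ g h = trans (sum-cong-≗ λ i → ∑-distrib-+ (g i) (h i)) (∑-distrib-+ (sum ∘ g) (sum ∘ h))

∑∑-partition : ∀ {n} (f u v w : Fin n → Fin n → ℕ) → (∀ i j → u i j + (v i j + w i j) ≡ 1) →
  ∑∑ f ≡ ∑∑ (λ i j → f i j * u i j) + (∑∑ (λ i j → f i j * v i j) + ∑∑ (λ i j → f i j * w i j))
∑∑-partition f u v w u+v+w≡1 = begin
  ∑∑ f
    ≡⟨ sum-cong-≗ (λ i → sum-cong-≗ λ j → split i j) ⟩
  ∑∑ (λ i j → f i j * u i j + (f i j * v i j + f i j * w i j))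
    ≡⟨ ∑∑-distrib-+ (λ i j → f i j * u i j) _ ⟩
  ∑∑ (λ i j → f i j * u i j) + ∑∑ (λ i j → f i j * v i j + f i j * w i j)
    ≡⟨ cong (∑∑ (λ i j → f i j * u i j) +_) (∑∑-distrib-+ (λ i j → f i j * v i j) (λ i j → f i j * w i j)) ⟩
  ∑∑ (λ i j → f i j * u i j) + (∑∑ (λ i j → f i j * v i j) + ∑∑ (λ i j → f i j * w i j)) ∎
  where
  open ≡-Reasoning
  split : ∀ i j → f i j ≡ f i j * u i j + (f i j * v i j + f i j * w i j)
  split i j = begin
    f i j                                   ≡⟨ ℕ.*-identityʳ (f i j) ⟨
    f i j * 1                               ≡⟨ cong (f i j *_) (u+v+w≡1 i j) ⟨
    f i j * (u i j + (v i j + w i j))       ≡⟨ ℕ.*-distribˡ-+ (f i j) (u i j) _ ⟩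
    f i j * u i j + f i j * (v i j + w i j) ≡⟨ cong (f i j * u i j +_) (ℕ.*-distribˡ-+ (f i j) (v i j) (w i j)) ⟩
    f i j * u i j + (f i j * v i j + f i j * w i j) ∎

-1^[k+k]≡1 : ∀ k → -1ℤ ^ℤ (k + k) ≡ 1ℤ
-1^[k+k]≡1 zero = refl
-1^[k+k]≡1 (suc k) rewrite ℕ.+-suc k k | -1^[k+k]≡1 k = refl

-1^[m+[k+k]]≡-1^m : ∀ m k → -1ℤ ^ℤ (m + (k + k)) ≡ -1ℤ ^ℤ m
-1^[m+[k+k]]≡-1^m m k = begin
  -1ℤ ^ℤ (m + (k + k))          ≡⟨ ℤ.^-distribˡ-+-* -1ℤ m (k + k) ⟩
  -1ℤ ^ℤ m *ℤ -1ℤ ^ℤ (k + k)    ≡⟨ cong (-1ℤ ^ℤ m *ℤ_) (-1^[k+k]≡1 k) ⟩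
  -1ℤ ^ℤ m *ℤ 1ℤ                ≡⟨ ℤ.*-identityʳ (-1ℤ ^ℤ m) ⟩
  -1ℤ ^ℤ m                      ∎
  where open ≡-Reasoning

module Involution {n} (π : Fin n → Fin n) (π-involutive : ∀ i → π (π i) ≡ i) where
  open ≡-Reasoning

  π-swap : ∀ {i j} → i ≡ π j → j ≡ π i
  π-swap {i} {j} i≡πj = trans (sym (π-involutive j)) (cong π (sym i≡πj))

  sum-reindex : (f : Fin n → ℕ) → sum f ≡ sum (f ∘ π)
  sum-reindex f = sum-permute f (permutation π π π-involutive π-involutive)

  ∑∑-reindex : (g : Fin n → Fin n → ℕ) → ∑∑ g ≡ ∑∑ (λ i j → g (π j) (π i))
  ∑∑-reindex g = begin
    ∑∑ g                                  ≡⟨ sum-cong-≗ (λ i → sum-reindex (g i)) ⟩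
    sum (λ i → sum (λ j → g i (π j)))     ≡⟨ sum-reindex (λ i → sum (λ j → g i (π j))) ⟩
    sum (λ i → sum (λ j → g (π i) (π j))) ≡⟨ ∑-comm (λ i j → g (π i) (π j)) ⟩
    ∑∑ (λ i j → g (π j) (π i))            ∎

  excedances : ℕ
  excedances = sum (λ i → 𝟙 (i <? π i))

  fixedPoints : ℕ
  fixedPoints = sum (λ i → 𝟙 (i ≟ π i))

  deficiencies≡excedances : sum (λ i → 𝟙 (π i <? i)) ≡ excedances
  deficiencies≡excedances = begin
    sum (λ i → 𝟙 (π i <? i))         ≡⟨ sum-reindex (λ i → 𝟙 (π i <? i)) ⟩
    sum (λ i → 𝟙 (π (π i) <? π i))   ≡⟨ sum-cong-≗ (λ i → cong (λ k → 𝟙 (k <? π i)) (π-involutive i)) ⟩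
    excedances                       ∎

  n≡fixedPoints+2*excedances : n ≡ fixedPoints + (excedances + excedances)
  n≡fixedPoints+2*excedances = begin
    n
      ≡⟨ sum-ones n ⟨
    sum {n} (λ _ → 1)
      ≡⟨ sum-cong-≗ (λ i → 𝟙-trichotomy i (π i)) ⟨
    sum (λ i → 𝟙 (i ≟ π i) + (𝟙 (i <? π i) + 𝟙 (π i <? i)))
      ≡⟨ ∑-distrib-+ (λ i → 𝟙 (i ≟ π i)) _ ⟩
    fixedPoints + sum (λ i → 𝟙 (i <? π i) + 𝟙 (π i <? i))
      ≡⟨ cong (fixedPoints +_) (∑-distrib-+ (λ i → 𝟙 (i <? π i)) _) ⟩
    fixedPoints + (excedances + sum (λ i → 𝟙 (π i <? i)))
      ≡⟨ cong (λ d → fixedPoints + (excedances + d)) deficiencies≡excedances ⟩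
    fixedPoints + (excedances + excedances) ∎

  inversion : Fin n → Fin n → ℕ
  inversion i j = 𝟙 (i <? j) * 𝟙 (π j <? π i)

  ∑∑-inversion-within-cycles : ∑∑ (λ i j → inversion i j * 𝟙 (i ≟ π j)) ≡ excedances
  ∑∑-inversion-within-cycles = sum-cong-≗ λ i → begin
    sum (λ j → inversion i j * 𝟙 (i ≟ π j))
      ≡⟨ sum-cong-≗ (λ j → cong (inversion i j *_) (𝟙-cong π-swap π-swap (i ≟ π j) (j ≟ π i))) ⟩
    sum (λ j → inversion i j * 𝟙 (j ≟ π i))
      ≡⟨ sum-δ (inversion i) (π i) ⟩
    𝟙 (i <? π i) * 𝟙 (π (π i) <? π i)
      ≡⟨ cong (λ k → 𝟙 (i <? π i) * 𝟙 (k <? π i)) (π-involutive i) ⟩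
    𝟙 (i <? π i) * 𝟙 (i <? π i)
      ≡⟨ 𝟙-idem (i <? π i) ⟩
    𝟙 (i <? π i) ∎

  ∑∑-inversion-above≡below :
    ∑∑ (λ i j → inversion i j * 𝟙 (π j <? i)) ≡ ∑∑ (λ i j → inversion i j * 𝟙 (i <? π j))
  ∑∑-inversion-above≡below =
    trans (∑∑-reindex (λ i j → inversion i j * 𝟙 (π j <? i))) (sum-cong-≗ λ i → sum-cong-≗ (swap i))
    where
    swap : ∀ i j → inversion (π j) (π i) * 𝟙 (π (π i) <? π j) ≡ inversion i j * 𝟙 (i <? π j)
    swap i j rewrite π-involutive i | π-involutive j =
      cong (_* 𝟙 (i <? π j)) (ℕ.*-comm (𝟙 (π j <? π i)) (𝟙 (i <? j)))

  sign≡-1^excedances : sign π ≡ -1ℤ ^ℤ excedances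
  sign≡-1^excedances = begin
    -1ℤ ^ℤ inversions π
      ≡⟨ cong (-1ℤ ^ℤ_) (inversions≡∑∑ π) ⟩
    -1ℤ ^ℤ ∑∑ inversion
      ≡⟨ cong (-1ℤ ^ℤ_) (∑∑-partition inversion _ _ _ (λ i j → 𝟙-trichotomy i (π j))) ⟩
    -1ℤ ^ℤ (∑∑ (λ i j → inversion i j * 𝟙 (i ≟ π j)) + (below + ∑∑ (λ i j → inversion i j * 𝟙 (π j <? i))))
      ≡⟨ cong₂ (λ e a → -1ℤ ^ℤ (e + (below + a))) ∑∑-inversion-within-cycles ∑∑-inversion-above≡below ⟩
    -1ℤ ^ℤ (excedances + (below + below))
      ≡⟨ -1^[m+[k+k]]≡-1^m excedances below ⟩
    -1ℤ ^ℤ excedances ∎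
    where below = ∑∑ (λ i j → inversion i j * 𝟙 (i <? π j))

-1^half : ∀ m c k → m ≡ (c + (k + k)) * 2 → -1ℤ ^ℤ (m / 2) ≡ -1ℤ ^ℤ c
-1^half _ c k refl = trans (cong (-1ℤ ^ℤ_) (m*n/n≡m (c + (k + k)) 2)) (-1^[m+[k+k]]≡-1^m c k)

-1^choose2 : ∀ c f → f ≤ 1 →
  -1ℤ ^ℤ ((f + (c + c)) * (f + (c + c) ∸ 1) / 2) ≡ -1ℤ ^ℤ c
-1^choose2 zero    zero          _         = refl
-1^choose2 (suc d) zero          _         = -1^half _ (suc d) (d * suc d) (even d)
  where
  even : ∀ d → suc (d + suc d) * (d + suc d) ≡ (suc d + (d * suc d + d * suc d)) * 2
  even = solve-∀
-1^choose2 c       (suc zero)    _         = -1^half _ c (c * c) (odd c)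
  where
  odd : ∀ c → suc (c + c) * (c + c) ≡ (c + (c * c + c * c)) * 2
  odd = solve-∀
-1^choose2 c       (suc (suc f)) (s≤s ())

sign-involution : ∀ {n} (π : Fin n → Fin n) → (∀ i → π (π i) ≡ i) →
  (∀ {i j} → i ≡ π i → j ≡ π j → i ≡ j) → sign π ≡ -1ℤ ^ℤ (n * (n ∸ 1) / 2)
sign-involution {n} π π-involutive fixedPoint-unique = begin
  sign π
    ≡⟨ sign≡-1^excedances ⟩
  -1ℤ ^ℤ excedances
    ≡⟨ -1^choose2 excedances fixedPoints (sum-𝟙≤1 (λ i → i ≟ π i) fixedPoint-unique) ⟨
  -1ℤ ^ℤ ((fixedPoints + (excedances + excedances)) * (fixedPoints + (excedances + excedances) ∸ 1) / 2)
    ≡⟨ cong (λ m → -1ℤ ^ℤ (m * (m ∸ 1) / 2)) n≡fixedPoints+2*excedances ⟨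
  -1ℤ ^ℤ (n * (n ∸ 1) / 2) ∎
  where
  open Involution π π-involutive
  open ≡-Reasoning

lemma3p3 : ∀ {c ℓ : Level} (F : Field c ℓ) (n : ℕ) →
           3 ≤ 2 + n → IsPrimePower (2 + n) →
           (a : Fin (2 + n) → Field.Carrier F) →
           (∀ i j → Field._≈_ F (a i) (a j) → i ≡ j) →
           (∀ x → ∃[ i ] Field._≈_ F (a i) x) →
           Field._≈_ F (a zero) (Field.0# F) →
           Field._≈_ F (a (suc zero)) (Field.1# F) →
           (π : Fin n → Fin n) →
           (∀ i → Field._≈_ F (a (2 ↑ʳ π i)) (Field._-_ F (Field.1# F) (a (2 ↑ʳ i)))) →
           sign π ≡ -1ℤ ^ℤ ((((2 + n) ∸ 2) * ((2 + n) ∸ 3)) / 2)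
lemma3p3 F n _ _ a a-injective _ _ _ π aπ≈1-a = sign-involution π π-involutive fixedPoint-unique
  where
  open Field F using (Carrier; _≈_; 1#; _-_; ring; semiring; +-congˡ; -‿cong) renaming (trans to ≈-trans)

  b : Fin n → Carrier
  b i = a (2 ↑ʳ i)

  b-injective : ∀ {i j} → b i ≈ b j → i ≡ j
  b-injective = ↑ʳ-injective 2 _ _ ∘ a-injective _ _

  π-involutive : ∀ i → π (π i) ≡ i
  π-involutive i =
    b-injective (≈-trans (aπ≈1-a (π i)) (≈-trans (+-congˡ (-‿cong (aπ≈1-a i))) (1-[1-x]≈x ring (b i))))

  fixed⇒b≈1-b : ∀ {i} → i ≡ π i → b i ≈ 1# - b i
  fixed⇒b≈1-b {i} i≡πi = subst (λ k → b k ≈ 1# - b i) (sym i≡πi) (aπ≈1-a i)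

  fixedPoint-unique : ∀ {i j} → i ≡ π i → j ≡ π j → i ≡ j
  fixedPoint-unique i≡πi j≡πj = b-injective (halves-unique semiring
    (x≈1-x⇒x+x≈1 ring (fixed⇒b≈1-b i≡πi)) (x≈1-x⇒x+x≈1 ring (fixed⇒b≈1-b j≡πj)))
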